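{- Let $A$ be a finite set of atoms, $P,R$ propositional Horn theories over $A$ and $B\subseteq A$. If neither $P$ nor $1_B$ depends on $R$ (i.e. $body(P)\cap head(R)=\emptyset$ and $B\cap head(R)=\emptyset$), then $$cl_B\big(cl_{head(R)}(P)\circ cl_{body(P)}(R)\big)=cl_{B\cup head(R)}(P)\circ cl_{B\cup body(P)}(R).$$
   Context: A theory over $A$ is a finite set of rules $a_0\leftarrow a_1,\ldots,a_k$ ($k\ge0$, $a_i\in A$), with $head(r)=\{a_0\}$, $body(r)=\{a_1,\ldots,a_k\}$, size $k$; $head(S),body(S)$ are unions over a set $S$ of rules. Write $S\subseteq_r R$ if $S\subseteq R$ has as many elements as the size of $r$. Composition: $P\circ R=\{head(r)\leftarrow body(S)\mid r\in P,\ S\subseteq_r R,\ head(S)=body(r)\}$. For $B\subseteq A$, $1_B=\{a\leftarrow a\mid a\in B\}$ and $cl_B(P)=1_B\cup P$. A theory $P$ depends on $R$ if $body(P)\cap head(R)\neq\emptyset$. -}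

module Defs where

open import Level using (0ℓ)
open import Data.Nat using (ℕ)
open import Data.Fin using (Fin)
open import Data.Fin.Subset using (Subset; ⁅_⁆; ⊥; _∪_; ∣_∣; _∈_)
open import Data.List using (List; []; _∷_; length)
open import Data.List.Relation.Unary.All using (All)
open import Data.List.Relation.Unary.Unique.Propositional using (Unique)
open import Data.Product using (Σ; _×_; _,_; proj₁; proj₂; ∃)
open import Data.Sum using (_⊎_)
open import Relation.Binary.PropositionalEquality using (_≡_)
open import Relation.Unary using (Pred) renaming (_∪_ to _∪ₚ_)

-- Atoms: the finite set A is Fin n.
-- A rule  a₀ ← a₁,…,a_k  is a head atom together with its (finite) body set.
Rule : ℕ → Set
Rule n = Fin n × Subset n

head : ∀ {n} → Rule n → Fin n
head = proj₁

body : ∀ {n} → Rule n → Subset n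
body = proj₂

size : ∀ {n} → Rule n → ℕ
size r = ∣ body r ∣

-- Sets of atoms and theories (sets of rules) as predicates.
-- (Every set of rules over Fin n is finite, since there are finitely many rules.)
Atoms : ℕ → Set₁
Atoms n = Pred (Fin n) 0ℓ

Theory : ℕ → Set₁
Theory n = Pred (Rule n) 0ℓ

headT : ∀ {n} → Theory n → Atoms n
headT P a = ∃ λ r → P r × head r ≡ a

bodyT : ∀ {n} → Theory n → Atoms n
bodyT P a = ∃ λ r → P r × a ∈ body r

headL : ∀ {n} → List (Rule n) → Subset n
headL []      = ⊥
headL (r ∷ S) = ⁅ head r ⁆ ∪ headL S

bodyL : ∀ {n} → List (Rule n) → Subset n
bodyL []      = ⊥
bodyL (r ∷ S) = body r ∪ bodyL S

_⊆[_]_ : ∀ {n} → List (Rule n) → Rule n → Theory n → Set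
S ⊆[ r ] R = Unique S × All R S × length S ≡ size r

_∘T_ : ∀ {n} → Theory n → Theory n → Theory n
(P ∘T R) r′ = ∃ λ r → P r × ∃ λ S → S ⊆[ r ] R × headL S ≡ body r × r′ ≡ (head r , bodyL S)

one : ∀ {n} → Atoms n → Theory n
one B r = B (head r) × body r ≡ ⁅ head r ⁆

cl : ∀ {n} → Atoms n → Theory n → Theory n
cl B P = one B ∪ₚ P

Disjoint : ∀ {n} → Atoms n → Atoms n → Set
Disjoint X Y = ∀ a → X a → Y a → Data.Empty.⊥
  where import Data.Empty

-- Both sides equal 1_B ∪ R ∪ P. Composing a rule with the identities on its body returns the
-- rule, and composing an identity a ← a with a theory returns that theory's rules with head a.
-- No body atom of P heads a rule of R, so a P-rule can only be composed with identities and P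
-- survives unchanged on each side; R arises from the identities on head(R); and the identities
-- that survive are exactly those on B, because body(P) and head(R) are disjoint.
module Submission where

open import Defs
open import Data.Nat using (ℕ; suc)
open import Data.Fin using (Fin; zero; suc)
open import Data.Fin.Properties using (suc-injective)
open import Data.Fin.Subset using (Subset; inside; outside; ⁅_⁆; ∣_∣; _∈_) renaming (_∪_ to _∪ˢ_; ⊥ to ∅)
open import Data.Fin.Subset.Properties using (∪-identityˡ; ∪-identityʳ; x∈⁅x⁆; x∈⁅y⁆⇒x≡y; ∣⁅x⁆∣≡1; p⊆p∪q; q⊆p∪q)
open import Data.Vec using ([]; _∷_; here; there)
open import Data.List using (List; []; _∷_; map; length)
open import Data.List.Properties using (length-map)
open import Data.List.Relation.Unary.All as All using (All; []; _∷_)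
open import Data.List.Relation.Unary.All.Properties as All using ()
open import Data.List.Relation.Unary.AllPairs using ([]; _∷_)
open import Data.List.Relation.Unary.Unique.Propositional using (Unique)
open import Data.List.Relation.Unary.Unique.Propositional.Properties as Unique using ()
open import Data.Product using (∃; _×_; _,_; proj₁)
open import Data.Sum using (inj₁; inj₂; map₂)
open import Data.Empty using (⊥-elim)
open import Function using (id)
open import Relation.Binary.PropositionalEquality
open import Relation.Unary using (_⊆_; _≐_; _∪_)
open import Relation.Unary.Properties using (≐-sym; ≐-trans)

Identity : ∀ {n} → Rule n → Set
Identity r = body r ≡ ⁅ head r ⁆

idRule : ∀ {n} → Fin n → Rule n
idRule a = a , ⁅ a ⁆

Composite : ∀ {n} → Theory n → Rule n → Rule n → Set
Composite U r r′ = ∃ λ S → S ⊆[ r ] U × headL S ≡ body r × r′ ≡ (head r , bodyL S)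

elements : ∀ {n} → Subset n → List (Fin n)
elements []            = []
elements (inside ∷ p)  = zero ∷ map suc (elements p)
elements (outside ∷ p) = map suc (elements p)

elements-unique : ∀ {n} (p : Subset n) → Unique (elements p)
elements-unique []            = []
elements-unique (inside ∷ p)  = zero∉map-suc (elements p) ∷ Unique.map⁺ suc-injective (elements-unique p)
  where
  zero∉map-suc : ∀ {n} (xs : List (Fin n)) → All (λ y → zero ≢ y) (map suc xs)
  zero∉map-suc []       = []
  zero∉map-suc (_ ∷ xs) = (λ ()) ∷ zero∉map-suc xs
elements-unique (outside ∷ p) = Unique.map⁺ suc-injective (elements-unique p)

elements-∈ : ∀ {n} (p : Subset n) → All (_∈ p) (elements p)
elements-∈ []            = []
elements-∈ (inside ∷ p)  = here ∷ All.map⁺ (All.map there (elements-∈ p))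
elements-∈ (outside ∷ p) = All.map⁺ (All.map there (elements-∈ p))

length-elements : ∀ {n} (p : Subset n) → length (elements p) ≡ ∣ p ∣
length-elements []            = refl
length-elements (inside ∷ p)  = cong suc (trans (length-map suc (elements p)) (length-elements p))
length-elements (outside ∷ p) = trans (length-map suc (elements p)) (length-elements p)

headL-map-idRule-suc : ∀ {n} (xs : List (Fin n)) →
  headL (map idRule (map suc xs)) ≡ outside ∷ headL (map idRule xs)
headL-map-idRule-suc []       = refl
headL-map-idRule-suc (x ∷ xs) = cong (⁅ suc x ⁆ ∪ˢ_) (headL-map-idRule-suc xs)

headL-identities : ∀ {n} (p : Subset n) → headL (map idRule (elements p)) ≡ p
headL-identities []            = refl
headL-identities (inside ∷ p)
  rewrite headL-map-idRule-suc (elements p) | headL-identities p = cong (inside ∷_) (∪-identityˡ p)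
headL-identities (outside ∷ p)
  rewrite headL-map-idRule-suc (elements p) | headL-identities p = refl

head∈headL : ∀ {n} (S : List (Rule n)) → All (λ s → head s ∈ headL S) S
head∈headL []      = []
head∈headL (s ∷ S) =
  p⊆p∪q (headL S) (x∈⁅x⁆ (head s)) ∷ All.map (q⊆p∪q ⁅ head s ⁆ (headL S)) (head∈headL S)

bodyL≡headL : ∀ {n} {S : List (Rule n)} → All Identity S → bodyL S ≡ headL S
bodyL≡headL []       = refl
bodyL≡headL (e ∷ es) = cong₂ _∪ˢ_ e (bodyL≡headL es)

identity-composite⁻ : ∀ {n} {X : Atoms n} {U : Theory n} {r r′ : Rule n} →
  one X r → Composite U r r′ → X (head r′) × U r′
identity-composite⁻ {r = r} (Xh , e) (S , (_ , US , |S|) , hS , refl) =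
  Xh , singleton S (trans |S| (trans (cong ∣_∣ e) (∣⁅x⁆∣≡1 (head r)))) US (trans hS e)
  where
  singleton : ∀ {U : Theory _} S → length S ≡ 1 → All U S → headL S ≡ ⁅ head r ⁆ → U (head r , bodyL S)
  singleton {U} (s ∷ []) _ (Us ∷ []) hS = subst U (cong₂ _,_ head-s≡head-r (sym (∪-identityʳ (body s)))) Us
    where
    head-s≡head-r : head s ≡ head r
    head-s≡head-r = x∈⁅y⁆⇒x≡y (head r) (subst (head s ∈_) hS (p⊆p∪q ∅ (x∈⁅x⁆ (head s))))

identity-composite⁺ : ∀ {n} {U : Theory n} {s : Rule n} → U s → Composite U (idRule (head s)) s
identity-composite⁺ {s = h , b} Us =
  (h , b) ∷ [] , ([] ∷ [] , Us ∷ [] , sym (∣⁅x⁆∣≡1 h)) , ∪-identityʳ ⁅ h ⁆ , cong (h ,_) (sym (∪-identityʳ b))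

-- Only identities can be used, so the body of S equals its head, which is body r.
composite-unchanged : ∀ {n} {U : Theory n} {r r′ : Rule n} →
  (∀ {s} → U s → head s ∈ body r → Identity s) → Composite U r r′ → r′ ≡ r
composite-unchanged {r = r} only-identities (S , (_ , US , _) , hS , refl) =
  cong (head r ,_) (trans (bodyL≡headL identities) hS)
  where
  identities : All Identity S
  identities = All.zipWith (λ (Us , s∈) → only-identities Us (subst (_ ∈_) hS s∈)) (US , head∈headL S)

composite-self : ∀ {n} {U : Theory n} {r : Rule n} →
  (∀ {a} → a ∈ body r → U (idRule a)) → Composite U r r
composite-self {r = h , b} identities-in-U =
  map idRule (elements b) ,
  (Unique.map⁺ (cong proj₁) (elements-unique b) ,
   All.map⁺ (All.map identities-in-U (elements-∈ b)) ,
   trans (length-map idRule (elements b)) (length-elements b)) ,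
  headL-identities b ,
  cong (h ,_) (sym (trans (bodyL≡headL (All.map⁺ (All.universal (λ _ → refl) (elements b))))
                          (headL-identities b)))

cl-cong : ∀ {n} (B : Atoms n) {T T′ : Theory n} → T ≐ T′ → cl B T ≐ cl B T′
cl-cong B (T⊆T′ , T′⊆T) = map₂ T⊆T′ , map₂ T′⊆T

module _ {n} {P R : Theory n} (body-P#head-R : Disjoint (bodyT P) (headT R)) where

  P-composite : ∀ {Y : Atoms n} {r r′ : Rule n} → P r → Composite (cl Y R) r r′ → P r′
  P-composite {Y} {r} Pr c = subst P (sym (composite-unchanged only-identities c)) Pr
    where
    only-identities : ∀ {s} → cl Y R s → head s ∈ body r → Identity s
    only-identities (inj₁ (_ , e)) _ = e
    only-identities {s} (inj₂ Rs) s∈ = ⊥-elim (body-P#head-R (head s) (r , Pr , s∈) (s , Rs , refl))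

  P⊆cl∘cl : ∀ {X Y : Atoms n} → bodyT P ⊆ Y → P ⊆ cl X P ∘T cl Y R
  P⊆cl∘cl body-P⊆Y {r} Pr = r , inj₂ Pr , composite-self (λ a∈ → inj₁ (body-P⊆Y (r , Pr , a∈) , refl))

  R⊆cl∘cl : ∀ {X Y : Atoms n} → headT R ⊆ X → R ⊆ cl X P ∘T cl Y R
  R⊆cl∘cl head-R⊆X {s} Rs = idRule (head s) , inj₁ (head-R⊆X (s , Rs , refl) , refl) , identity-composite⁺ (inj₂ Rs)

  cl-head-R-∘-cl-body-P : cl (headT R) P ∘T cl (bodyT P) R ≐ R ∪ P
  cl-head-R-∘-cl-body-P = into , from
    where
    into : cl (headT R) P ∘T cl (bodyT P) R ⊆ R ∪ P
    into (r , inj₁ id-r , c) with identity-composite⁻ id-r c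
    ... | hR , inj₁ (bP , _) = ⊥-elim (body-P#head-R _ bP hR)
    ... | _  , inj₂ Rr′      = inj₁ Rr′
    into (r , inj₂ Pr , c) = inj₂ (P-composite Pr c)
    from : R ∪ P ⊆ cl (headT R) P ∘T cl (bodyT P) R
    from (inj₁ Rs) = R⊆cl∘cl id Rs
    from (inj₂ Pr) = P⊆cl∘cl id Pr

  cl-B∪head-R-∘-cl-B∪body-P : ∀ (B : Atoms n) →
    cl (B ∪ headT R) P ∘T cl (B ∪ bodyT P) R ≐ cl B (R ∪ P)
  cl-B∪head-R-∘-cl-B∪body-P B = into , from
    where
    into : cl (B ∪ headT R) P ∘T cl (B ∪ bodyT P) R ⊆ cl B (R ∪ P)
    into (r , inj₁ id-r , c) with identity-composite⁻ {X = B ∪ headT R} id-r c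
    ... | _       , inj₂ Rr′             = inj₂ (inj₁ Rr′)
    ... | _       , inj₁ (inj₁ Bh , e)     = inj₁ (Bh , e)
    ... | inj₁ Bh , inj₁ (inj₂ _ , e)      = inj₁ (Bh , e)
    ... | inj₂ hR , inj₁ (inj₂ bP , _)     = ⊥-elim (body-P#head-R _ bP hR)
    into (r , inj₂ Pr , c) = inj₂ (inj₂ (P-composite Pr c))
    from : cl B (R ∪ P) ⊆ cl (B ∪ headT R) P ∘T cl (B ∪ bodyT P) R
    from {s} (inj₁ (Bh , e)) = idRule (head s) , inj₁ (inj₁ Bh , refl) , identity-composite⁺ (inj₁ (inj₁ Bh , e))
    from (inj₂ (inj₁ Rs)) = R⊆cl∘cl inj₂ Rs
    from (inj₂ (inj₂ Pr)) = P⊆cl∘cl inj₂ Pr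

lemma5p5 : (n : ℕ) (P R : Theory n) (B : Atoms n) →
    Disjoint (bodyT P) (headT R) →
    Disjoint B (headT R) →
    cl B (cl (headT R) P ∘T cl (bodyT P) R) ≐ (cl (B ∪ headT R) P ∘T cl (B ∪ bodyT P) R)
lemma5p5 n P R B body-P#head-R _ =
  ≐-trans (cl-cong B (cl-head-R-∘-cl-body-P body-P#head-R))
          (≐-sym (cl-B∪head-R-∘-cl-B∪body-P body-P#head-R B))
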